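{- Let $n$ be an even positive integer and let $K_{n,n}$ be the complete bipartite graph with both parts of size $n$. Then no nonzero real number is a root of the domination polynomial $D(K_{n,n},x)$.
   Context: For a simple graph $G=(V,E)$, a set $S\subseteq V$ is dominating if every vertex of $V\setminus S$ is adjacent to at least one vertex of $S$. Writing $d(G,i)$ for the number of dominating sets of $G$ of cardinality $i$ and $\gamma(G)$ for the minimum cardinality of a dominating set, the domination polynomial is $D(G,x)=\sum_{i=\gamma(G)}^{|V|} d(G,i)x^i$. A root of $D(G,x)$ is called a domination root of $G$. -}

module Defs where

open import Level using (Level; _⊔_) renaming (suc to lsuc)
open import Data.Nat using (ℕ; zero; suc; _<ᵇ_)
open import Data.Bool using (Bool; true; false; _xor_)
open import Data.Bool.Properties using (xor-comm)
open import Data.Fin using (Fin; toℕ)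
open import Data.Fin.Subset using (Subset; _∈_; ∣_∣)
open import Data.Fin.Subset.Properties using (_∈?_)
open import Data.Fin.Properties using (any?; all?)
open import Data.Vec using (Vec; []; _∷_)
open import Data.List using (List; []; _∷_; map; _++_; filter; length)
open import Data.Product using (Σ; ∃; _×_; _,_)
open import Data.Sum using (_⊎_)
open import Relation.Nullary using (Dec; ¬_)
open import Relation.Nullary.Decidable using (_×-dec_; _⊎-dec_)
open import Relation.Binary using (Rel; IsStrictTotalOrder)
open import Relation.Binary.PropositionalEquality using (_≡_; refl)
open import Algebra.Bundles using (CommutativeRing)
import Data.Nat as ℕ

record SimpleGraph : Set where
  field
    V       : ℕ
    Adj     : Fin V → Fin V → Bool
    sym     : ∀ u v → Adj u v ≡ Adj v u
    irrefl  : ∀ v → Adj v v ≡ false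

open SimpleGraph public

Dominating : (G : SimpleGraph) → Subset (V G) → Set
Dominating G S = ∀ v → v ∈ S ⊎ ∃ λ u → u ∈ S × Adj G u v ≡ true

dominating? : (G : SimpleGraph) (S : Subset (V G)) → Dec (Dominating G S)
dominating? G S =
  all? λ v → (v ∈? S) ⊎-dec any? (λ u → (u ∈? S) ×-dec (Adj G u v Data.Bool.≟ true))

allSubsets : (n : ℕ) → List (Subset n)
allSubsets zero    = [] ∷ []
allSubsets (suc n) = map (true ∷_) (allSubsets n) ++ map (false ∷_) (allSubsets n)

d : SimpleGraph → ℕ → ℕ
d G i = length (filter (λ S → dominating? G S ×-dec (∣ S ∣ ℕ.≟ i)) (allSubsets (V G)))

-- Complete bipartite graph K_{n,n}: vertices Fin (n ℕ.+ n); vertex v lies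
-- in the first part iff toℕ v < n; u ~ v iff they lie in different parts.

side : (n : ℕ) → Fin (n ℕ.+ n) → Bool
side n v = toℕ v <ᵇ n

xor-self : ∀ b → b xor b ≡ false
xor-self true  = refl
xor-self false = refl

K : ℕ → SimpleGraph
K n = record
  { V      = n ℕ.+ n
  ; Adj    = λ u v → side n u xor side n v
  ; sym    = λ u v → xor-comm (side n u) (side n v)
  ; irrefl = λ v → xor-self (side n v)
  }

record OrderedField c ℓ₁ ℓ₂ : Set (lsuc (c ⊔ ℓ₁ ⊔ ℓ₂)) where
  field
    commutativeRing : CommutativeRing c ℓ₁
  open CommutativeRing commutativeRing public
  field
    _<_                : Rel Carrier ℓ₂
    isStrictTotalOrder : IsStrictTotalOrder _≈_ _<_
    +-monoˡ-<          : ∀ z {x y} → x < y → (x + z) < (y + z)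
    *-pos              : ∀ {x y} → 0# < x → 0# < y → 0# < (x * y)
    0<1                : 0# < 1#
    inverse            : ∀ x → ¬ (x ≈ 0#) → ∃ λ y → (x * y) ≈ 1#

module _ {c ℓ₁ ℓ₂} (F : OrderedField c ℓ₁ ℓ₂) where
  open OrderedField F using (Carrier; _+_; _*_; 0#; 1#)

  pow : Carrier → ℕ → Carrier
  pow x zero    = 1#
  pow x (suc k) = x * pow x k

  fromℕ : ℕ → Carrier
  fromℕ zero    = 0#
  fromℕ (suc m) = 1# + fromℕ m

  sumUpTo : ℕ → (ℕ → Carrier) → Carrier
  sumUpTo zero    f = f zero
  sumUpTo (suc k) f = sumUpTo k f + f (suc k)

  D : SimpleGraph → Carrier → Carrier
  D G x = sumUpTo (V G) (λ i → fromℕ (d G i) * pow x i)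

module Submission where

-- Write the vertex set of K_{n,n} as a left part and a right part, so that a
-- vertex subset is a pair (s , t) of subsets of Fin n.  Such a pair is
-- dominating iff (s is full or t is nonempty) and (t is full or s is
-- nonempty).  For n ≥ 1 the indicator of this condition splits as
--   [s ≠ ∅][t ≠ ∅] + [s = ∅][t full] + [s full][t = ∅],
-- and summing x^|s| x^|t| over all pairs gives
--   D(K_{n,n}, x) = A² + x^n + x^n,   A = Σ_{s ≠ ∅} x^|s|.
-- For even n and x ≠ 0 the power x^n is a nonzero square, hence positive,
-- while A² ≥ 0; so D(K_{n,n}, x) > 0.

open import Defs hiding (sym; irrefl)
open import Data.Nat using (ℕ; _≤_)
open import Data.Product using (∃)
open import Relation.Binary.PropositionalEquality using (_≡_)
open import Relation.Nullary using (¬_)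

import Data.Nat as ℕ
import Data.Nat.Properties as ℕ
open import Data.Bool using (Bool; true; false; T; not; _∧_; _∨_; _xor_)
open import Data.Bool.Properties using (T-∧; T-∨; T-≡)
open import Data.Fin using (Fin; zero; suc; toℕ; _↑ˡ_; _↑ʳ_; splitAt)
import Data.Fin.Properties as Fin
open import Data.Fin.Subset using (Subset; _∈_; ∣_∣)
open import Data.Fin.Subset.Properties using (drop-there; ∣p∣≤n)
open import Data.Vec using ([]; _∷_; _++_; here; there)
open import Data.Vec.Properties using (lookup-++ˡ; lookup-++ʳ; []=⇒lookup; lookup⇒[]=)
open import Data.List using (List; []; _∷_; map; filter; length) renaming (_++_ to _++ₗ_)
open import Data.Product using (_×_; _,_; proj₂)
open import Data.Product.Function.NonDependent.Propositional using (_×-⇔_)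
open import Data.Sum using (_⊎_; inj₁; inj₂; [_,_])
open import Data.Empty using (⊥-elim)
open import Data.Maybe using (nothing)
open import Function using (_∘_; id; _⇔_; mk⇔; Equivalence)
import Function.Properties.Equivalence as ⇔
open import Relation.Nullary using (Dec; yes; no; does; contradiction)
open import Relation.Nullary.Decidable using (dec-true; dec-false; does-⇔; T?; _×-dec_)
open import Relation.Binary using (tri<; tri≈; tri>; IsStrictTotalOrder)
open import Relation.Binary.PropositionalEquality as ≡ using (refl; cong; cong₂; subst)
open import Algebra.Bundles using (Semiring; CommutativeMonoid)
open import Tactic.RingSolver.Core.AlmostCommutativeRing using (fromCommutativeRing)

open Equivalence using (to; from)

anyIn : ∀ {m} → Subset m → Bool
anyIn []      = false
anyIn (b ∷ s) = b ∨ anyIn s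

allIn : ∀ {m} → Subset m → Bool
allIn []      = true
allIn (b ∷ s) = b ∧ allIn s

anyIn-complete : ∀ {m} {i : Fin m} {s : Subset m} → i ∈ s → T (anyIn s)
anyIn-complete {s = true ∷ _}  _         = _
anyIn-complete {s = false ∷ _} (there p) = anyIn-complete p

anyIn-sound : ∀ {m} (s : Subset m) → T (anyIn s) → ∃ (_∈ s)
anyIn-sound (true ∷ s)  _ = zero , here
anyIn-sound (false ∷ s) p with i , i∈s ← anyIn-sound s p = suc i , there i∈s

allIn-sound : ∀ {m} (s : Subset m) → T (allIn s) → ∀ i → i ∈ s
allIn-sound (true ∷ s) _ zero    = here
allIn-sound (true ∷ s) p (suc i) = there (allIn-sound s p i)

allIn-complete : ∀ {m} (s : Subset m) → (∀ i → i ∈ s) → T (allIn s)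
allIn-complete []          _   = _
allIn-complete (true ∷ s)  all = allIn-complete s (drop-there ∘ all ∘ suc)
allIn-complete (false ∷ s) all with () ← all zero

allIn⇒anyIn : ∀ {m} → 1 ≤ m → (s : Subset m) → T (allIn s) → T (anyIn s)
allIn⇒anyIn (ℕ.s≤s _) (true ∷ _) _ = _

∣++∣ : ∀ {m n} (s : Subset m) (t : Subset n) → ∣ s ++ t ∣ ≡ ∣ s ∣ ℕ.+ ∣ t ∣
∣++∣ []          t = refl
∣++∣ (true ∷ s)  t = cong ℕ.suc (∣++∣ s t)
∣++∣ (false ∷ s) t = ∣++∣ s t

∈-++ˡ : ∀ {m n} (s : Subset m) (t : Subset n) i → (i ↑ˡ n ∈ s ++ t) ⇔ (i ∈ s)
∈-++ˡ s t i = mk⇔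
  (λ p → lookup⇒[]= i s (≡.trans (≡.sym (lookup-++ˡ s t i)) ([]=⇒lookup p)))
  (λ p → lookup⇒[]= _ (s ++ t) (≡.trans (lookup-++ˡ s t i) ([]=⇒lookup p)))

∈-++ʳ : ∀ {m n} (s : Subset m) (t : Subset n) j → (m ↑ʳ j ∈ s ++ t) ⇔ (j ∈ t)
∈-++ʳ s t j = mk⇔
  (λ p → lookup⇒[]= j t (≡.trans (≡.sym (lookup-++ʳ s t j)) ([]=⇒lookup p)))
  (λ p → lookup⇒[]= _ (s ++ t) (≡.trans (lookup-++ʳ s t j) ([]=⇒lookup p)))

bit : Bool → ℕ
bit false = 0
bit true  = 1

length-filter-∷ : ∀ {A : Set} {P : A → Set} (P? : ∀ a → Dec (P a)) a L →
  length (filter P? (a ∷ L)) ≡ bit (does (P? a)) ℕ.+ length (filter P? L)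
length-filter-∷ P? a L with does (P? a)
... | true  = refl
... | false = refl

data Part (n : ℕ) : Fin (n ℕ.+ n) → Set where
  left  : (i : Fin n) → Part n (i ↑ˡ n)
  right : (j : Fin n) → Part n (n ↑ʳ j)

part : ∀ n v → Part n v
part n v with splitAt n v | Fin.join-splitAt n n v
... | inj₁ i | refl = left i
... | inj₂ j | refl = right j

side-left : ∀ n (i : Fin n) → side n (i ↑ˡ n) ≡ true
side-left n i = to T-≡ (ℕ.<⇒<ᵇ (subst (ℕ._< n) (≡.sym (Fin.toℕ-↑ˡ i n)) (Fin.toℕ<n i)))

side-right : ∀ n (j : Fin n) → side n (n ↑ʳ j) ≡ false
side-right n j rewrite Fin.toℕ-↑ʳ n j = n+k≮ᵇn n (toℕ j)
  where
  n+k≮ᵇn : ∀ n k → ((n ℕ.+ k) ℕ.<ᵇ n) ≡ false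
  n+k≮ᵇn ℕ.zero    k = refl
  n+k≮ᵇn (ℕ.suc n) k = n+k≮ᵇn n k

adjacent-left-right : ∀ n i j → Adj (K n) (i ↑ˡ n) (n ↑ʳ j) ≡ true
adjacent-left-right n i j = cong₂ _xor_ (side-left n i) (side-right n j)

adjacent-right-left : ∀ n j i → Adj (K n) (n ↑ʳ j) (i ↑ˡ n) ≡ true
adjacent-right-left n j i = cong₂ _xor_ (side-right n j) (side-left n i)

neighbour-of-left : ∀ n {u} i → Adj (K n) u (i ↑ˡ n) ≡ true → ∃ λ j → u ≡ n ↑ʳ j
neighbour-of-left n {u} i adj with part n u
... | right j = j , refl
... | left i′ with () ← ≡.trans (≡.sym adj) (cong₂ _xor_ (side-left n i′) (side-left n i))

neighbour-of-right : ∀ n {u} j → Adj (K n) u (n ↑ʳ j) ≡ true → ∃ λ i → u ≡ i ↑ˡ n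
neighbour-of-right n {u} j adj with part n u
... | left i = i , refl
... | right j′ with () ← ≡.trans (≡.sym adj) (cong₂ _xor_ (side-right n j′) (side-right n j))

-- Dominating sets of K_{n,n}

-- Every vertex of one part lies in s or has a neighbour in t (the other part).
Covers : ∀ {n} → Subset n → Subset n → Set
Covers s t = ∀ i → i ∈ s ⊎ ∃ (_∈ t)

dominating-K⇔ : ∀ n (s t : Subset n) → Dominating (K n) (s ++ t) ⇔ (Covers s t × Covers t s)
dominating-K⇔ n s t = mk⇔ (λ dom → covers-left dom , covers-right dom) dominating
  where
  covers-left : Dominating (K n) (s ++ t) → Covers s t
  covers-left dom i with dom (i ↑ˡ n)
  ... | inj₁ i∈ = inj₁ (to (∈-++ˡ s t i) i∈)
  ... | inj₂ (u , u∈ , adj) with j , refl ← neighbour-of-left n i adj =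
    inj₂ (j , to (∈-++ʳ s t j) u∈)

  covers-right : Dominating (K n) (s ++ t) → Covers t s
  covers-right dom j with dom (n ↑ʳ j)
  ... | inj₁ j∈ = inj₁ (to (∈-++ʳ s t j) j∈)
  ... | inj₂ (u , u∈ , adj) with i , refl ← neighbour-of-right n j adj =
    inj₂ (i , to (∈-++ˡ s t i) u∈)

  dominating : Covers s t × Covers t s → Dominating (K n) (s ++ t)
  dominating (cov-s , cov-t) v with part n v
  ... | left i with cov-s i
  ...   | inj₁ i∈       = inj₁ (from (∈-++ˡ s t i) i∈)
  ...   | inj₂ (j , j∈) = inj₂ (n ↑ʳ j , from (∈-++ʳ s t j) j∈ , adjacent-right-left n j i)
  dominating (cov-s , cov-t) v | right j with cov-t j
  ...   | inj₁ j∈       = inj₁ (from (∈-++ʳ s t j) j∈)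
  ...   | inj₂ (i , i∈) = inj₂ (i ↑ˡ n , from (∈-++ˡ s t i) i∈ , adjacent-left-right n i j)

covers⇔ : ∀ {n} (s t : Subset n) → Covers s t ⇔ T (allIn s ∨ anyIn t)
covers⇔ s t = mk⇔ covers⇒ ⇒covers
  where
  covers⇒ : Covers s t → T (allIn s ∨ anyIn t)
  covers⇒ cov with T? (anyIn t)
  ... | yes t≠∅ = from T-∨ (inj₂ t≠∅)
  ... | no  t=∅ = from T-∨ (inj₁ (allIn-complete s
                    (λ i → [ id , (λ j∈ → contradiction (anyIn-complete (proj₂ j∈)) t=∅) ] (cov i))))

  ⇒covers : T (allIn s ∨ anyIn t) → Covers s t
  ⇒covers h i with to T-∨ h
  ... | inj₁ full   = inj₁ (allIn-sound s full i)
  ... | inj₂ t≠∅    = inj₂ (anyIn-sound t t≠∅)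

dominating?-K : ∀ n (s t : Subset n) →
  does (dominating? (K n) (s ++ t)) ≡ (allIn s ∨ anyIn t) ∧ (allIn t ∨ anyIn s)
dominating?-K n s t = does-⇔ characterisation (dominating? (K n) (s ++ t)) (T? _)
  where
  characterisation : Dominating (K n) (s ++ t) ⇔ T ((allIn s ∨ anyIn t) ∧ (allIn t ∨ anyIn s))
  characterisation = ⇔.trans (dominating-K⇔ n s t) (⇔.trans (covers⇔ s t ×-⇔ covers⇔ t s) (⇔.sym T-∧))

-- When full implies nonempty, the domination condition is the disjoint union
--   (s ≠ ∅ ∧ t ≠ ∅)  ⊎  (s = ∅ ∧ t full)  ⊎  (s full ∧ t = ∅).
dominates-split : ∀ as es at et → (T as → T es) → (T at → T et) →
  bit ((as ∨ et) ∧ (at ∨ es)) ≡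
  bit es ℕ.* bit et ℕ.+ bit (not es) ℕ.* bit at ℕ.+ bit as ℕ.* bit (not et)
dominates-split true  false _     _     full⇒ _     = ⊥-elim (full⇒ _)
dominates-split _     _     true  false _     full⇒ = ⊥-elim (full⇒ _)
dominates-split false false false false _ _ = refl
dominates-split false false false true  _ _ = refl
dominates-split false false true  true  _ _ = refl
dominates-split false true  false false _ _ = refl
dominates-split false true  false true  _ _ = refl
dominates-split false true  true  true  _ _ = refl
dominates-split true  true  false false _ _ = refl
dominates-split true  true  false true  _ _ = refl
dominates-split true  true  true  true  _ _ = refl

-- Finite sums in a semiring

module Sums {c ℓ} (R : Semiring c ℓ) where
  open Semiring R renaming (refl to ≈-refl)
  open import Relation.Binary.Reasoning.Setoid setoid
  open import Algebra.Properties.CommutativeSemigroup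
    (CommutativeMonoid.commutativeSemigroup +-commutativeMonoid) using (interchange)

  sumOver : ∀ {A : Set} → List A → (A → Carrier) → Carrier
  sumOver []      f = 0#
  sumOver (a ∷ L) f = f a + sumOver L f

  module _ {A : Set} where

    sumOver-cong : ∀ (L : List A) {f g} → (∀ a → f a ≈ g a) → sumOver L f ≈ sumOver L g
    sumOver-cong []      _ = ≈-refl
    sumOver-cong (a ∷ L) e = +-cong (e a) (sumOver-cong L e)

    sumOver-zero : ∀ (L : List A) {f} → (∀ a → f a ≈ 0#) → sumOver L f ≈ 0#
    sumOver-zero []      _ = ≈-refl
    sumOver-zero (a ∷ L) e = trans (+-cong (e a) (sumOver-zero L e)) (+-identityˡ 0#)

    sumOver-++ : ∀ (L M : List A) f → sumOver (L ++ₗ M) f ≈ sumOver L f + sumOver M f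
    sumOver-++ []      M f = sym (+-identityˡ _)
    sumOver-++ (a ∷ L) M f = trans (+-congˡ (sumOver-++ L M f)) (sym (+-assoc _ _ _))

    sumOver-+ : ∀ (L : List A) f g → sumOver L (λ a → f a + g a) ≈ sumOver L f + sumOver L g
    sumOver-+ []      f g = sym (+-identityˡ 0#)
    sumOver-+ (a ∷ L) f g = trans (+-congˡ (sumOver-+ L f g)) (interchange _ _ _ _)

    sumOver-*ˡ : ∀ (L : List A) y f → sumOver L (λ a → y * f a) ≈ y * sumOver L f
    sumOver-*ˡ []      y f = sym (zeroʳ y)
    sumOver-*ˡ (a ∷ L) y f = trans (+-congˡ (sumOver-*ˡ L y f)) (sym (distribˡ y _ _))

    sumOver-*ʳ : ∀ (L : List A) y f → sumOver L (λ a → f a * y) ≈ sumOver L f * y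
    sumOver-*ʳ []      y f = sym (zeroˡ y)
    sumOver-*ʳ (a ∷ L) y f = trans (+-congˡ (sumOver-*ʳ L y f)) (sym (distribʳ y _ _))

  sumOver-map : ∀ {A B : Set} (h : A → B) (L : List A) f → sumOver (map h L) f ≡ sumOver L (f ∘ h)
  sumOver-map h []      f = refl
  sumOver-map h (a ∷ L) f = cong (f (h a) +_) (sumOver-map h L f)

  sumOver-product : ∀ {A B : Set} (L : List A) (M : List B) f g →
    sumOver L (λ a → sumOver M (λ b → f a * g b)) ≈ sumOver L f * sumOver M g
  sumOver-product L M f g = begin
    sumOver L (λ a → sumOver M (λ b → f a * g b)) ≈⟨ sumOver-cong L (λ a → sumOver-*ˡ M (f a) g) ⟩
    sumOver L (λ a → f a * sumOver M g)          ≈⟨ sumOver-*ʳ L (sumOver M g) f ⟩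
    sumOver L f * sumOver M g                     ∎

  sumOver-allSubsets-suc : ∀ m f →
    sumOver (allSubsets (ℕ.suc m)) f ≈
    sumOver (allSubsets m) (f ∘ (true ∷_)) + sumOver (allSubsets m) (f ∘ (false ∷_))
  sumOver-allSubsets-suc m f = begin
    sumOver (map (true ∷_) (allSubsets m) ++ₗ map (false ∷_) (allSubsets m)) f
      ≈⟨ sumOver-++ (map (true ∷_) (allSubsets m)) _ f ⟩
    sumOver (map (true ∷_) (allSubsets m)) f + sumOver (map (false ∷_) (allSubsets m)) f
      ≡⟨ cong₂ _+_ (sumOver-map (true ∷_) (allSubsets m) f) (sumOver-map (false ∷_) (allSubsets m) f) ⟩
    sumOver (allSubsets m) (f ∘ (true ∷_)) + sumOver (allSubsets m) (f ∘ (false ∷_)) ∎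

  sumOver-allSubsets-++ : ∀ a b f →
    sumOver (allSubsets (a ℕ.+ b)) f ≈ sumOver (allSubsets a) (λ s → sumOver (allSubsets b) (λ t → f (s ++ t)))
  sumOver-allSubsets-++ ℕ.zero    b f = sym (+-identityʳ _)
  sumOver-allSubsets-++ (ℕ.suc a) b f = begin
    sumOver (allSubsets (ℕ.suc a ℕ.+ b)) f
      ≈⟨ sumOver-allSubsets-suc (a ℕ.+ b) f ⟩
    sumOver (allSubsets (a ℕ.+ b)) (f ∘ (true ∷_)) + sumOver (allSubsets (a ℕ.+ b)) (f ∘ (false ∷_))
      ≈⟨ +-cong (sumOver-allSubsets-++ a b (f ∘ (true ∷_))) (sumOver-allSubsets-++ a b (f ∘ (false ∷_))) ⟩
    sumOver (allSubsets a) (inner ∘ (true ∷_)) + sumOver (allSubsets a) (inner ∘ (false ∷_))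
      ≈⟨ sumOver-allSubsets-suc a inner ⟨
    sumOver (allSubsets (ℕ.suc a)) inner ∎
    where
    inner : Subset (ℕ.suc a) → Carrier
    inner s = sumOver (allSubsets b) (λ t → f (s ++ t))

-- The domination polynomial in an ordered field

module Polynomial {c ℓ₁ ℓ₂} (F : OrderedField c ℓ₁ ℓ₂) where
  open OrderedField F renaming (refl to ≈-refl)
  open import Relation.Binary.Reasoning.Setoid setoid
  open import Algebra.Properties.Semiring.Mult semiring using (×-homo-+; ×1-homo-*) renaming (_×_ to _×ₙ_)
  open import Algebra.Properties.Semiring.Exp semiring using (_^_; ^-homo-*)
  open import Tactic.RingSolver.NonReflective (fromCommutativeRing commutativeRing (λ _ → nothing))
    using (solve; _⊜_; _⊕_; _⊗_)
  open Sums semiring public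

  fromℕ≡×1 : ∀ m → fromℕ F m ≡ m ×ₙ 1#
  fromℕ≡×1 ℕ.zero    = refl
  fromℕ≡×1 (ℕ.suc m) = cong (1# +_) (fromℕ≡×1 m)

  pow≡^ : ∀ x k → pow F x k ≡ x ^ k
  pow≡^ x ℕ.zero    = refl
  pow≡^ x (ℕ.suc k) = cong (x *_) (pow≡^ x k)

  fromℕ-+ : ∀ a b → fromℕ F (a ℕ.+ b) ≈ fromℕ F a + fromℕ F b
  fromℕ-+ a b rewrite fromℕ≡×1 (a ℕ.+ b) | fromℕ≡×1 a | fromℕ≡×1 b = ×-homo-+ 1# a b

  fromℕ-* : ∀ a b → fromℕ F (a ℕ.* b) ≈ fromℕ F a * fromℕ F b
  fromℕ-* a b rewrite fromℕ≡×1 (a ℕ.* b) | fromℕ≡×1 a | fromℕ≡×1 b = ×1-homo-* a b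

  χ : Bool → Carrier
  χ b = fromℕ F (bit b)

  χ-true : ∀ y → χ true * y ≈ y
  χ-true y = trans (*-congʳ (+-identityʳ 1#)) (*-identityˡ y)

  χ-false : ∀ y → χ false * y ≈ 0#
  χ-false = zeroˡ

  χ-dominates-split : ∀ as es at et → (T as → T es) → (T at → T et) →
    χ ((as ∨ et) ∧ (at ∨ es)) ≈ χ es * χ et + χ (not es) * χ at + χ as * χ (not et)
  χ-dominates-split as es at et s-full⇒ t-full⇒ = begin
    χ ((as ∨ et) ∧ (at ∨ es))
      ≡⟨ cong (fromℕ F) (dominates-split as es at et s-full⇒ t-full⇒) ⟩
    fromℕ F (p₁ ℕ.* q₁ ℕ.+ p₂ ℕ.* q₂ ℕ.+ p₃ ℕ.* q₃)
      ≈⟨ trans (fromℕ-+ (p₁ ℕ.* q₁ ℕ.+ p₂ ℕ.* q₂) (p₃ ℕ.* q₃)) (+-congʳ (fromℕ-+ (p₁ ℕ.* q₁) (p₂ ℕ.* q₂))) ⟩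
    fromℕ F (p₁ ℕ.* q₁) + fromℕ F (p₂ ℕ.* q₂) + fromℕ F (p₃ ℕ.* q₃)
      ≈⟨ +-cong (+-cong (fromℕ-* p₁ q₁) (fromℕ-* p₂ q₂)) (fromℕ-* p₃ q₃) ⟩
    χ es * χ et + χ (not es) * χ at + χ as * χ (not et) ∎
    where
    p₁ q₁ p₂ q₂ p₃ q₃ : ℕ
    p₁ = bit es
    q₁ = bit et
    p₂ = bit (not es)
    q₂ = bit at
    p₃ = bit as
    q₃ = bit (not et)

  sumUpTo-cong : ∀ m {f g} → (∀ i → f i ≈ g i) → sumUpTo F m f ≈ sumUpTo F m g
  sumUpTo-cong ℕ.zero    e = e 0
  sumUpTo-cong (ℕ.suc m) e = +-cong (sumUpTo-cong m e) (e (ℕ.suc m))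

  sumUpTo-+ : ∀ m f g → sumUpTo F m (λ i → f i + g i) ≈ sumUpTo F m f + sumUpTo F m g
  sumUpTo-+ ℕ.zero    f g = ≈-refl
  sumUpTo-+ (ℕ.suc m) f g = trans (+-congʳ (sumUpTo-+ m f g)) (interchange _ _ _ _)
    where open import Algebra.Properties.CommutativeSemigroup +-commutativeSemigroup using (interchange)

  sumUpTo-zero : ∀ m f → (∀ i → i ≤ m → f i ≈ 0#) → sumUpTo F m f ≈ 0#
  sumUpTo-zero ℕ.zero    f e = e 0 ℕ.z≤n
  sumUpTo-zero (ℕ.suc m) f e =
    trans (+-cong (sumUpTo-zero m f (λ i i≤m → e i (ℕ.m≤n⇒m≤1+n i≤m))) (e (ℕ.suc m) ℕ.≤-refl)) (+-identityˡ 0#)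

  δ-same : ∀ k y → χ (does (k ℕ.≟ k)) * y ≈ y
  δ-same k y rewrite dec-true (k ℕ.≟ k) refl = χ-true y

  δ-other : ∀ {k i} y → ¬ k ≡ i → χ (does (k ℕ.≟ i)) * y ≈ 0#
  δ-other {k} {i} y k≢i rewrite dec-false (k ℕ.≟ i) k≢i = χ-false y

  sumUpTo-δ : ∀ m {k} (f : ℕ → Carrier) → k ≤ m → sumUpTo F m (λ i → χ (does (k ℕ.≟ i)) * f i) ≈ f k
  sumUpTo-δ ℕ.zero    f ℕ.z≤n = δ-same 0 (f 0)
  sumUpTo-δ (ℕ.suc m) {k} f k≤1+m with k ℕ.≟ ℕ.suc m
  ... | yes refl = trans (+-cong earlier-terms (δ-same (ℕ.suc m) _)) (+-identityˡ _)
    where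
    earlier-terms : sumUpTo F m (λ i → χ (does (ℕ.suc m ℕ.≟ i)) * f i) ≈ 0#
    earlier-terms = sumUpTo-zero m _ (λ i i≤m → δ-other {ℕ.suc m} {i} (f i) (λ { refl → ℕ.<-irrefl refl (ℕ.s≤s i≤m) }))
  ... | no  k≢1+m = trans (+-cong (sumUpTo-δ m f k≤m) (δ-other {k} {ℕ.suc m} _ k≢1+m)) (+-identityʳ _)
    where
    k≤m : k ≤ m
    k≤m = ℕ.≤-pred (ℕ.≤∧≢⇒< k≤1+m k≢1+m)

  module _ (x : Carrier) where

    counting-polynomial : ∀ {m} {P : Subset m → Set} (P? : ∀ S → Dec (P S)) (L : List (Subset m)) →
      sumUpTo F m (λ i → fromℕ F (length (filter (λ S → P? S ×-dec (∣ S ∣ ℕ.≟ i)) L)) * pow F x i)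
        ≈ sumOver L (λ S → χ (does (P? S)) * x ^ ∣ S ∣)
    counting-polynomial {m} P? []      = sumUpTo-zero m _ (λ i _ → zeroˡ _)
    counting-polynomial {m} P? (S ∷ L) = begin
      sumUpTo F m (λ i → fromℕ F (count (S ∷ L) i) * pow F x i)
        ≈⟨ sumUpTo-cong m (λ i → trans (*-congʳ (fromℕ-split i)) (distribʳ _ _ _)) ⟩
      sumUpTo F m (λ i → χ (does (P? S) ∧ does (∣ S ∣ ℕ.≟ i)) * pow F x i + fromℕ F (count L i) * pow F x i)
        ≈⟨ sumUpTo-+ m _ _ ⟩
      sumUpTo F m (λ i → χ (does (P? S) ∧ does (∣ S ∣ ℕ.≟ i)) * pow F x i)
        + sumUpTo F m (λ i → fromℕ F (count L i) * pow F x i)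
        ≈⟨ +-cong (head-term (does (P? S))) (counting-polynomial P? L) ⟩
      χ (does (P? S)) * x ^ ∣ S ∣ + sumOver L (λ S → χ (does (P? S)) * x ^ ∣ S ∣) ∎
      where
      count : List (Subset m) → ℕ → ℕ
      count Ss i = length (filter (λ S → P? S ×-dec (∣ S ∣ ℕ.≟ i)) Ss)

      fromℕ-split : ∀ i → fromℕ F (count (S ∷ L) i) ≈ χ (does (P? S) ∧ does (∣ S ∣ ℕ.≟ i)) + fromℕ F (count L i)
      fromℕ-split i rewrite length-filter-∷ (λ S → P? S ×-dec (∣ S ∣ ℕ.≟ i)) S L =
        fromℕ-+ (bit (does (P? S) ∧ does (∣ S ∣ ℕ.≟ i))) (count L i)

      head-term : ∀ b → sumUpTo F m (λ i → χ (b ∧ does (∣ S ∣ ℕ.≟ i)) * pow F x i) ≈ χ b * x ^ ∣ S ∣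
      head-term false = trans (sumUpTo-zero m _ (λ i _ → χ-false _)) (sym (χ-false _))
      head-term true  = begin
        sumUpTo F m (λ i → χ (does (∣ S ∣ ℕ.≟ i)) * pow F x i) ≈⟨ sumUpTo-δ m (pow F x) (∣p∣≤n S) ⟩
        pow F x ∣ S ∣                                          ≡⟨ pow≡^ x ∣ S ∣ ⟩
        x ^ ∣ S ∣                                              ≈⟨ χ-true _ ⟨
        χ true * x ^ ∣ S ∣                                     ∎

    D-as-sum : ∀ G → D F G x ≈ sumOver (allSubsets (V G)) (λ S → χ (does (dominating? G S)) * x ^ ∣ S ∣)
    D-as-sum G = counting-polynomial (dominating? G) (allSubsets (V G))

    nonemptyW emptyW fullW : ∀ {m} → Subset m → Carrier
    nonemptyW s = χ (anyIn s) * x ^ ∣ s ∣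
    emptyW    s = χ (not (anyIn s)) * x ^ ∣ s ∣
    fullW     s = χ (allIn s) * x ^ ∣ s ∣

    -- Only the empty set is empty, with weight x^0 = 1.
    emptyW-sum : ∀ m → sumOver (allSubsets m) emptyW ≈ 1#
    emptyW-sum ℕ.zero    = trans (+-identityʳ _) (χ-true _)
    emptyW-sum (ℕ.suc m) = begin
      sumOver (allSubsets (ℕ.suc m)) emptyW
        ≈⟨ sumOver-allSubsets-suc m emptyW ⟩
      sumOver (allSubsets m) (emptyW ∘ (true ∷_)) + sumOver (allSubsets m) emptyW
        ≈⟨ +-cong (sumOver-zero (allSubsets m) (λ _ → χ-false _)) (emptyW-sum m) ⟩
      0# + 1#
        ≈⟨ +-identityˡ 1# ⟩
      1# ∎

    -- Only the full set is full, with weight x^m.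
    fullW-sum : ∀ m → sumOver (allSubsets m) fullW ≈ x ^ m
    fullW-sum ℕ.zero    = trans (+-identityʳ _) (χ-true _)
    fullW-sum (ℕ.suc m) = begin
      sumOver (allSubsets (ℕ.suc m)) fullW
        ≈⟨ sumOver-allSubsets-suc m fullW ⟩
      sumOver (allSubsets m) (fullW ∘ (true ∷_)) + sumOver (allSubsets m) (fullW ∘ (false ∷_))
        ≈⟨ +-cong (sumOver-cong (allSubsets m) (λ s → x-out (χ (allIn s)) (x ^ ∣ s ∣)))
                  (sumOver-zero (allSubsets m) (λ _ → χ-false _)) ⟩
      sumOver (allSubsets m) (λ s → x * fullW s) + 0#
        ≈⟨ +-identityʳ _ ⟩
      sumOver (allSubsets m) (λ s → x * fullW s)
        ≈⟨ sumOver-*ˡ (allSubsets m) x fullW ⟩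
      x * sumOver (allSubsets m) fullW
        ≈⟨ *-congˡ (fullW-sum m) ⟩
      x ^ ℕ.suc m ∎
      where
      x-out : ∀ a w → a * (x * w) ≈ x * (a * w)
      x-out = solve 3 (λ x a w → (a ⊗ (x ⊗ w)) ⊜ (x ⊗ (a ⊗ w))) ≈-refl x

    term-K : ∀ {n} → 1 ≤ n → (s t : Subset n) →
      χ (does (dominating? (K n) (s ++ t))) * x ^ ∣ s ++ t ∣ ≈
      nonemptyW s * nonemptyW t + emptyW s * fullW t + fullW s * emptyW t
    term-K {n} 1≤n s t = begin
      χ (does (dominating? (K n) (s ++ t))) * x ^ ∣ s ++ t ∣
        ≡⟨ cong₂ (λ b k → χ b * x ^ k) (dominating?-K n s t) (∣++∣ s t) ⟩
      χ ((allIn s ∨ anyIn t) ∧ (allIn t ∨ anyIn s)) * x ^ (∣ s ∣ ℕ.+ ∣ t ∣)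
        ≈⟨ *-cong (χ-dominates-split (allIn s) (anyIn s) (allIn t) (anyIn t)
                     (allIn⇒anyIn 1≤n s) (allIn⇒anyIn 1≤n t))
                  (^-homo-* x ∣ s ∣ ∣ t ∣) ⟩
      (χ (anyIn s) * χ (anyIn t) + χ (not (anyIn s)) * χ (allIn t) + χ (allIn s) * χ (not (anyIn t)))
        * (x ^ ∣ s ∣ * x ^ ∣ t ∣)
        ≈⟨ distribute _ _ _ _ _ _ _ _ ⟩
      nonemptyW s * nonemptyW t + emptyW s * fullW t + fullW s * emptyW t ∎
      where
      distribute : ∀ p₁ q₁ p₂ q₂ p₃ q₃ a b →
        (p₁ * q₁ + p₂ * q₂ + p₃ * q₃) * (a * b) ≈ (p₁ * a) * (q₁ * b) + (p₂ * a) * (q₂ * b) + (p₃ * a) * (q₃ * b)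
      distribute = solve 8 (λ p₁ q₁ p₂ q₂ p₃ q₃ a b →
        ((p₁ ⊗ q₁ ⊕ p₂ ⊗ q₂ ⊕ p₃ ⊗ q₃) ⊗ (a ⊗ b)) ⊜ ((p₁ ⊗ a) ⊗ (q₁ ⊗ b) ⊕ (p₂ ⊗ a) ⊗ (q₂ ⊗ b) ⊕ (p₃ ⊗ a) ⊗ (q₃ ⊗ b))) ≈-refl

    D-K : ∀ n → 1 ≤ n → D F (K n) x ≈ sumOver (allSubsets n) nonemptyW * sumOver (allSubsets n) nonemptyW + (x ^ n + x ^ n)
    D-K n 1≤n = begin
      D F (K n) x
        ≈⟨ D-as-sum (K n) ⟩
      sumOver (allSubsets (n ℕ.+ n)) (λ S → χ (does (dominating? (K n) S)) * x ^ ∣ S ∣)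
        ≈⟨ sumOver-allSubsets-++ n n _ ⟩
      ΣΣ (λ s t → χ (does (dominating? (K n) (s ++ t))) * x ^ ∣ s ++ t ∣)
        ≈⟨ sumOver-cong Sn (λ s → sumOver-cong Sn (term-K 1≤n s)) ⟩
      ΣΣ (λ s t → nonemptyW s * nonemptyW t + emptyW s * fullW t + fullW s * emptyW t)
        ≈⟨ trans (ΣΣ-+ _ _) (+-congʳ (ΣΣ-+ _ _)) ⟩
      ΣΣ (λ s t → nonemptyW s * nonemptyW t) + ΣΣ (λ s t → emptyW s * fullW t) + ΣΣ (λ s t → fullW s * emptyW t)
        ≈⟨ +-cong (+-cong (sumOver-product Sn Sn _ _) (sumOver-product Sn Sn _ _)) (sumOver-product Sn Sn _ _) ⟩
      A * A + sumOver Sn emptyW * sumOver Sn fullW + sumOver Sn fullW * sumOver Sn emptyW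
        ≈⟨ +-cong (+-congˡ (*-cong (emptyW-sum n) (fullW-sum n))) (*-cong (fullW-sum n) (emptyW-sum n)) ⟩
      A * A + 1# * x ^ n + x ^ n * 1#
        ≈⟨ trans (+-assoc _ _ _) (+-congˡ (+-cong (*-identityˡ _) (*-identityʳ _))) ⟩
      A * A + (x ^ n + x ^ n) ∎
      where
      Sn : List (Subset n)
      Sn = allSubsets n
      A : Carrier
      A = sumOver Sn nonemptyW
      ΣΣ : (Subset n → Subset n → Carrier) → Carrier
      ΣΣ f = sumOver Sn (λ s → sumOver Sn (f s))
      ΣΣ-+ : ∀ f g → ΣΣ (λ s t → f s t + g s t) ≈ ΣΣ f + ΣΣ g
      ΣΣ-+ f g = trans (sumOver-cong Sn (λ s → sumOver-+ Sn (f s) (g s))) (sumOver-+ Sn _ _)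

-- Positivity in ordered fields

module Positivity {c ℓ₁ ℓ₂} (F : OrderedField c ℓ₁ ℓ₂) where
  open OrderedField F
  open IsStrictTotalOrder isStrictTotalOrder using (compare; asym; <-respʳ-≈; <-respˡ-≈)
    renaming (trans to <-trans; irrefl to <-irrefl)
  open import Relation.Binary.Reasoning.Setoid setoid
  open import Algebra.Properties.Semiring.Exp semiring using (_^_; ^-homo-*; ^-congʳ)
  open import Algebra.Properties.Ring ring using (-‿distribˡ-*; -‿distribʳ-*; -‿involutive)

  nonzero-cancel : ∀ {x y} → ¬ x ≈ 0# → x * y ≈ 0# → y ≈ 0#
  nonzero-cancel {x} {y} x≉0 xy≈0 with x⁻¹ , xx⁻¹≈1 ← inverse x x≉0 = begin
    y               ≈⟨ *-identityˡ y ⟨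
    1# * y          ≈⟨ *-congʳ (trans (sym xx⁻¹≈1) (*-comm x x⁻¹)) ⟩
    (x⁻¹ * x) * y   ≈⟨ *-assoc x⁻¹ x y ⟩
    x⁻¹ * (x * y)   ≈⟨ *-congˡ xy≈0 ⟩
    x⁻¹ * 0#        ≈⟨ zeroʳ x⁻¹ ⟩
    0#              ∎

  ^-nonzero : ∀ {x} → ¬ x ≈ 0# → ∀ k → ¬ x ^ k ≈ 0#
  ^-nonzero x≉0 ℕ.zero    1≈0 = <-irrefl (sym 1≈0) 0<1
  ^-nonzero x≉0 (ℕ.suc k) xᵏ⁺¹≈0 = ^-nonzero x≉0 k (nonzero-cancel x≉0 xᵏ⁺¹≈0)

  neg-pos : ∀ {x} → x < 0# → 0# < (- x)
  neg-pos {x} x<0 = <-respˡ-≈ (-‿inverseʳ x) (<-respʳ-≈ (+-identityˡ (- x)) (+-monoˡ-< (- x) x<0))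

  square-pos : ∀ {x} → ¬ x ≈ 0# → 0# < (x * x)
  square-pos {x} x≉0 with compare x 0#
  ... | tri< x<0 _ _ = <-respʳ-≈ (neg-square x) (*-pos (neg-pos x<0) (neg-pos x<0))
    where
    neg-square : ∀ x → (- x) * (- x) ≈ x * x
    neg-square x = begin
      (- x) * (- x)   ≈⟨ -‿distribˡ-* x (- x) ⟨
      - (x * - x)     ≈⟨ -‿cong (-‿distribʳ-* x x) ⟨
      - (- (x * x))   ≈⟨ -‿involutive (x * x) ⟩
      x * x           ∎
  ... | tri≈ _ x≈0 _ = contradiction x≈0 x≉0
  ... | tri> _ _ 0<x = *-pos 0<x 0<x

  square-nonneg : ∀ x → ¬ ((x * x) < 0#)
  square-nonneg x with compare x 0#
  ... | tri< _ x≉0 _ = asym (square-pos x≉0)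
  ... | tri≈ _ x≈0 _ = <-irrefl (trans (*-congʳ x≈0) (zeroˡ x))
  ... | tri> _ x≉0 _ = asym (square-pos x≉0)

  even-power-pos : ∀ {x} → ¬ x ≈ 0# → ∀ k → 0# < (x ^ (2 ℕ.* k))
  even-power-pos {x} x≉0 k = <-respʳ-≈ xᵏxᵏ≈x²ᵏ (square-pos (^-nonzero x≉0 k))
    where
    xᵏxᵏ≈x²ᵏ : x ^ k * x ^ k ≈ x ^ (2 ℕ.* k)
    xᵏxᵏ≈x²ᵏ = sym (trans (^-homo-* x k (k ℕ.+ 0)) (*-congˡ (^-congʳ x (ℕ.+-identityʳ k))))

  pos+pos : ∀ {a b} → 0# < a → 0# < b → 0# < (a + b)
  pos+pos {a} {b} 0<a 0<b = <-trans (<-respʳ-≈ (sym (+-identityˡ b)) 0<b) (+-monoˡ-< b 0<a)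

  nonneg+pos : ∀ {a b} → ¬ a < 0# → 0# < b → 0# < (a + b)
  nonneg+pos {a} {b} a≮0 0<b with compare a 0#
  ... | tri< a<0 _ _ = contradiction a<0 a≮0
  ... | tri≈ _ a≈0 _ = <-respʳ-≈ (trans (sym (+-identityˡ b)) (+-congʳ (sym a≈0))) 0<b
  ... | tri> _ _ 0<a = pos+pos 0<a 0<b

open import Data.Nat using (_*_)

theorem2p3 : ∀ {c ℓ₁ ℓ₂} (F : OrderedField c ℓ₁ ℓ₂) (n : ℕ) → 1 ≤ n → (∃ λ k → n ≡ 2 * k) →
    ∀ (x : OrderedField.Carrier F) → ¬ (OrderedField._≈_ F x (OrderedField.0# F)) →
    ¬ (OrderedField._≈_ F (D F (K n) x) (OrderedField.0# F))
theorem2p3 F n 1≤n (k , refl) x x≉0 D≈0 = <-irrefl (sym D≈0) D-positive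
  where
  open OrderedField F using (_<_; 0#; sym; isStrictTotalOrder)
  open IsStrictTotalOrder isStrictTotalOrder using (<-respʳ-≈) renaming (irrefl to <-irrefl)
  open Polynomial F using (D-K; sumOver; nonemptyW)
  open Positivity F using (nonneg+pos; square-nonneg; pos+pos; even-power-pos)

  -- D(K_{n,n}, x) = A² + x^n + x^n with A² ≥ 0 and x^n > 0.
  D-positive : 0# < D F (K n) x
  D-positive = <-respʳ-≈ (sym (D-K x n 1≤n))
    (nonneg+pos (square-nonneg (sumOver (allSubsets n) (nonemptyW x)))
                (pos+pos (even-power-pos x≉0 k) (even-power-pos x≉0 k)))
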